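{- Fix $n\ge1$ and let $u,v$ be independent, each uniformly distributed on $S_n$. For every $1\le i\le n$, \[\mathbb E\Big[\max_{i\le k\le n+1}\big(Y_k(u,v)-Y_i(u,v)\big)\Big]\le\sum_{j=i}^n\frac1{j^2}.\]
   Context: View $w\in S_n$ as a permutation of the positive integers fixing every $j>n$. For $j\ge1$, $\chi_j(w)=1$ if there exists $k<j$ with $w(k)>w(j)$, else $\chi_j(w)=0$; $\Lambda_i(w)=\sum_{j\ge i}\chi_j(w)$; and $Y_i(u,v)=\Lambda_i(u)+\Lambda_i(v)+i-1$. -}

module Defs where

open import Data.Bool using (Bool; true; false; if_then_else_; not; _∧_)
open import Data.Nat as ℕ using (ℕ; zero; suc; _∸_; _<ᵇ_; _≡ᵇ_; _≤ᵇ_)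
open import Data.Fin using (Fin; toℕ; fromℕ<)
open import Data.List as L using (List; []; _∷_; concatMap; map; allFin; filter; length)
open import Data.Bool.ListAction using (any)
open import Data.Nat.ListAction using (sum)
open import Data.Vec as V using (Vec; []; _∷_; lookup)
open import Data.Integer as ℤ using (ℤ; +_; _⊔_)
open import Data.Rational as ℚ using (ℚ; 0ℚ)
open import Relation.Nullary using (yes; no)

range : ℕ → ℕ → List ℕ
range a b = L.map (a ℕ.+_) (L.upTo (suc b ∸ a))

allVecs : (m k : ℕ) → List (Vec (Fin m) k)
allVecs m zero = [] ∷ []
allVecs m (suc k) = concatMap (λ x → map (x ∷_) (allVecs m k)) (allFin m)

distinct : ∀ {m k} → Vec (Fin m) k → Bool
distinct [] = true
distinct (x ∷ xs) = not (V.foldr _ (λ y b → (toℕ x ≡ᵇ toℕ y) Data.Bool.∨ b) false xs) ∧ distinct xs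

-- S_n: permutations of {1,...,n}, encoded as the vector (w(1)-1, ..., w(n)-1).
-- A length-n vector over Fin n with distinct entries is exactly a bijection.
Perm : ℕ → Set
Perm n = Vec (Fin n) n

allPerms : (n : ℕ) → List (Perm n)
allPerms n = filter (λ w → Data.Bool._≟_ (distinct w) true) (allVecs n n)

-- w viewed as a permutation of the positive integers fixing every j > n
-- (the value at 0 is irrelevant; positions are 1-based).
ext : ∀ {n} → Perm n → ℕ → ℕ
ext {n} w zero = zero
ext {n} w (suc j) with j ℕ.<? n
... | yes p = suc (toℕ (lookup w (fromℕ< p)))
... | no _ = suc j

χ : ∀ {n} → ℕ → Perm n → ℕ
χ j w = if any (λ k → ext w j <ᵇ ext w k) (range 1 (j ∸ 1)) then 1 else 0

-- Λ_i(w) = Σ_{j ≥ i} χ_j(w); χ_j(w) = 0 for j > n, so the sum stops at n.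
Λ : ∀ {n} → ℕ → Perm n → ℕ
Λ {n} i w = sum (map (λ j → χ j w) (range i n))

Y : ∀ {n} → ℕ → Perm n → Perm n → ℤ
Y i u v = + (Λ i u ℕ.+ Λ i v ℕ.+ (i ∸ 1))

M : ∀ {n} → ℕ → Perm n → Perm n → ℤ
M {n} i u v = L.foldr (λ k acc → (Y k u v ℤ.- Y i u v) ⊔ acc) (Y i u v ℤ.- Y i u v) (range i (suc n))

sumℚ : List ℚ → ℚ
sumℚ = L.foldr ℚ._+_ 0ℚ

average : List ℚ → ℚ
average [] = 0ℚ
average (x ∷ xs) = sumℚ (x ∷ xs) ℚ.* (+ 1 ℚ./ suc (length xs))

-- E[ max_{i ≤ k ≤ n+1} (Y_k(u,v) - Y_i(u,v)) ] for u, v independent uniform on S_n.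
expectedMax : (n i : ℕ) → ℚ
expectedMax n i = average (concatMap (λ u → map (λ v → (M i u v ℚ./ 1)) (allPerms n)) (allPerms n))

-- Σ_{j=i}^{n} 1/j²  (for i ≥ 1; the j = 0 term, never used, is set to 0)
invSq : ℕ → ℚ
invSq zero = 0ℚ
invSq (suc j) = + 1 ℚ./ (suc j ℕ.* suc j)

sumInvSq : ℕ → ℕ → ℚ
sumInvSq i n = sumℚ (map invSq (range i n))

-- Write Y_{k+1} − Y_k = 1 − χ_k(u) − χ_k(v). Whenever this increment is positive, k is a
-- left-to-right maximum (a record) of both u and v, so every increment is at most the product of
-- the two record indicators at k; summing, max_k (Y_k − Y_i) is at most the number of common
-- records of u and v at positions ≥ i. By independence of u and v, the expectation of that number
-- is Σ_{j ≥ i} P(j is a record)². Finally P(j is a record) ≤ 1/j: exchanging the entry at j with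
-- any of the entries at positions 1, …, j maps each permutation with a record at j to j distinct
-- permutations, and images of different permutations are different.

module Submission where

open import Defs
open import Data.Bool using (Bool; true; false; _∨_; T; if_then_else_)
open import Data.Bool.ListAction using (any)
import Data.Bool.Properties as Boolₚ
open import Data.Empty using (⊥-elim)
open import Data.Fin as Fin using (Fin; toℕ)
import Data.Fin.Properties as Finₚ
open import Data.Fin.Permutation.Components using (transpose; transpose-inverse)
open import Data.Integer as ℤ using (ℤ; _⊔_; _⊖_)
import Data.Integer.Properties as ℤₚ
open import Data.List as List
  using (List; []; _∷_; _++_; map; upTo; applyUpTo; allFin; cartesianProductWith; concatMap; filter; length)
import Data.List.Properties as Listₚ
open import Data.List.Membership.Propositional using (_∈_; lose; find)
open import Data.List.Membership.Propositional.Properties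
  using (∈-applyUpTo⁺; ∈-applyUpTo⁻; ∈-cartesianProductWith⁺; ∈-allFin; ∈-filter⁺; ∈-filter⁻;
         ∈-lookup; ∈-concatMap⁻; ∈-map⁻)
open import Data.List.Relation.Binary.Disjoint.Propositional using (Disjoint)
open import Data.List.Relation.Binary.Subset.Propositional using (_⊆_)
open import Data.List.Relation.Unary.All as All using (All; []; _∷_)
open import Data.List.Relation.Unary.Any as Any using (here; there)
open import Data.List.Relation.Unary.Any.Properties using (lookup-index; any⁺)
open import Data.List.Relation.Unary.Unique.Propositional using (Unique; []; _∷_)
import Data.List.Relation.Unary.Unique.Propositional.Properties as Uniqueₚ
open import Data.Nat as ℕ using (ℕ; zero; suc; _+_; _*_; _∸_; _≤_; _<_; z≤n; s≤s; _≡ᵇ_; _<ᵇ_)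
import Data.Nat.Properties as ℕₚ
open import Data.Nat.ListAction using (sum)
open import Data.Nat.Tactic.RingSolver using (solve-∀)
open import Data.Rational as ℚ using (ℚ; 0ℚ)
open import Data.Rational using () renaming (_≤_ to _≤ℚ_)
import Data.Rational.Properties as ℚₚ
open import Data.Rational.Unnormalised as ℚᵘ using (mkℚᵘ; *≡*; *≤*)
import Data.Rational.Unnormalised.Properties as ℚᵘₚ
open import Data.Product using (∃; _×_; _,_; proj₁; proj₂)
open import Data.Sum using (_⊎_; inj₁; inj₂)
open import Data.Vec as Vec using (Vec; []; _∷_; lookup)
import Data.Vec.Properties as Vecₚ
open import Function using (Injective; Equivalence; _∘_; _∘′_)
open import Relation.Nullary using (¬_; does; yes; no; contradiction)
open import Relation.Nullary.Decidable using (dec-true)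
open import Relation.Unary using (Decidable)
open import Relation.Binary.PropositionalEquality

private
  range≡applyUpTo : ∀ a b → range a b ≡ applyUpTo (a +_) (suc b ∸ a)
  range≡applyUpTo a b = Listₚ.map-applyUpTo (λ x → x) (a +_) (suc b ∸ a)

∈-range⁻ : ∀ {a b k} → k ∈ range a b → a ≤ k × k ≤ b
∈-range⁻ {a} {b} k∈ with i , i<b+1-a , refl ← ∈-applyUpTo⁻ (a +_) (subst (_ ∈_) (range≡applyUpTo a b) k∈) =
  ℕₚ.m≤m+n a i , subst (_≤ b) (ℕₚ.+-comm i a) (ℕₚ.≤-pred (ℕₚ.m≤o∸n⇒m+n≤o (suc i) a≤b+1 i<b+1-a))
  where a≤b+1 : a ≤ suc b
        a≤b+1 = ℕₚ.<⇒≤ (ℕₚ.m∸n≢0⇒n<m λ e → ℕₚ.n≮0 (subst (i <_) e i<b+1-a))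

∈-range⁺ : ∀ {a b k} → a ≤ k → k ≤ b → k ∈ range a b
∈-range⁺ {a} {b} {k} a≤k k≤b = subst (_∈ range a b) (ℕₚ.m+[n∸m]≡n a≤k)
  (subst (_ ∈_) (sym (range≡applyUpTo a b)) (∈-applyUpTo⁺ (a +_) (ℕₚ.∸-monoˡ-< (s≤s k≤b) a≤k)))

range-∷ : ∀ {a b} → a ≤ b → range a b ≡ a ∷ range (suc a) b
range-∷ {a} {b} a≤b = begin
  map (a +_) (upTo (suc b ∸ a))              ≡⟨ cong (map (a +_) ∘′ upTo) (ℕₚ.+-∸-assoc 1 a≤b) ⟩
  a + 0 ∷ map (a +_) (applyUpTo suc (b ∸ a)) ≡⟨ cong₂ _∷_ (ℕₚ.+-identityʳ a)
                                                   (cong (map (a +_)) (sym (Listₚ.map-applyUpTo (λ x → x) suc _))) ⟩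
  a ∷ map (a +_) (map suc (upTo (b ∸ a)))   ≡⟨ cong (a ∷_) (sym (Listₚ.map-∘ (upTo (b ∸ a)))) ⟩
  a ∷ map (λ x → a + suc x) (upTo (b ∸ a))  ≡⟨ cong (a ∷_) (Listₚ.map-cong (ℕₚ.+-suc a) (upTo (b ∸ a))) ⟩
  a ∷ range (suc a) b                        ∎
  where open ≡-Reasoning

sum-range-∷ : ∀ (f : ℕ → ℕ) {a b} → a ≤ b → sum (map f (range a b)) ≡ f a + sum (map f (range (suc a) b))
sum-range-∷ f a≤b = cong (sum ∘ map f) (range-∷ a≤b)

unique⇒lookup-injective : ∀ {A : Set} {xs : List A} → Unique xs → Injective _≡_ _≡_ (List.lookup xs)
unique⇒lookup-injective {xs = x ∷ xs} (x∉xs ∷ u) {Fin.zero}  {Fin.zero}  _ = refl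
unique⇒lookup-injective {xs = x ∷ xs} (x∉xs ∷ u) {Fin.zero}  {Fin.suc j} e = contradiction e (All.lookup x∉xs (∈-lookup j))
unique⇒lookup-injective {xs = x ∷ xs} (x∉xs ∷ u) {Fin.suc i} {Fin.zero}  e = contradiction (sym e) (All.lookup x∉xs (∈-lookup i))
unique⇒lookup-injective {xs = x ∷ xs} (x∉xs ∷ u) {Fin.suc i} {Fin.suc j} e = cong Fin.suc (unique⇒lookup-injective u e)

unique∧⊆⇒length-≤ : ∀ {A : Set} {xs ys : List A} → Unique xs → xs ⊆ ys → length xs ≤ length ys
unique∧⊆⇒length-≤ {xs = xs} {ys} u xs⊆ys = Finₚ.injective⇒≤ {f = position} position-injective
  where
  position : Fin (length xs) → Fin (length ys)
  position i = Any.index (xs⊆ys (∈-lookup i))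

  position-injective : Injective _≡_ _≡_ position
  position-injective {i} {j} e = unique⇒lookup-injective u (begin
    List.lookup xs i            ≡⟨ lookup-index (xs⊆ys (∈-lookup i)) ⟩
    List.lookup ys (position i) ≡⟨ cong (List.lookup ys) e ⟩
    List.lookup ys (position j) ≡⟨ sym (lookup-index (xs⊆ys (∈-lookup j))) ⟩
    List.lookup xs j            ∎)
    where open ≡-Reasoning

concatMap-unique : ∀ {A B : Set} (g : A → List B) {xs : List A} → Unique xs →
  (∀ {x} → x ∈ xs → Unique (g x)) →
  (∀ {x y} → x ∈ xs → y ∈ xs → x ≢ y → Disjoint (g x) (g y)) → Unique (concatMap g xs)
concatMap-unique g {[]}     _            _       _        = []
concatMap-unique g {x ∷ xs} (x∉xs ∷ u) unique-g disjoint =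
  Uniqueₚ.++⁺ (unique-g (here refl)) (concatMap-unique g u (unique-g ∘ there) (λ x∈ y∈ → disjoint (there x∈) (there y∈)))
    λ (b∈gx , b∈rest) → let y , y∈xs , b∈gy = find (∈-concatMap⁻ g b∈rest) in
      disjoint (here refl) (there y∈xs) (All.lookup x∉xs y∈xs) (b∈gx , b∈gy)

length-concatMap : ∀ {A B : Set} (g : A → List B) {c} → (∀ x → length (g x) ≡ c) →
                   ∀ xs → length (concatMap g xs) ≡ length xs * c
length-concatMap g g-const []       = refl
length-concatMap g g-const (x ∷ xs) =
  trans (Listₚ.length-++ (g x)) (cong₂ _+_ (g-const x) (length-concatMap g g-const xs))

cartesianProductWith-concatMap : ∀ {A B C : Set} (f : A → B → C) xs ys →
  concatMap (λ x → map (f x) ys) xs ≡ cartesianProductWith f xs ys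
cartesianProductWith-concatMap f []       ys = refl
cartesianProductWith-concatMap f (x ∷ xs) ys = cong (map (f x) ys List.++_) (cartesianProductWith-concatMap f xs ys)

foldr-⊔-≤ : ∀ {A : Set} (g : A → ℤ) {base c} (xs : List A) → base ℤ.≤ c → All (λ x → g x ℤ.≤ c) xs →
            List.foldr (λ x acc → g x ⊔ acc) base xs ℤ.≤ c
foldr-⊔-≤ g []       base≤c []         = base≤c
foldr-⊔-≤ g (x ∷ xs) base≤c (gx≤c ∷ p) = ℤₚ.⊔-lub gx≤c (foldr-⊔-≤ g xs base≤c p)

sum-map-+ : ∀ {A : Set} (g h : A → ℕ) xs → sum (map (λ x → g x + h x) xs) ≡ sum (map g xs) + sum (map h xs)
sum-map-+ g h []       = refl
sum-map-+ g h (x ∷ xs) = trans (cong (g x + h x +_) (sum-map-+ g h xs)) (interchange (g x) (h x) _ _)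
  where
  interchange : ∀ a b c d → a + b + (c + d) ≡ a + c + (b + d)
  interchange = solve-∀

sum-map-swap : ∀ {A B : Set} (f : A → B → ℕ) xs ys →
  sum (map (λ x → sum (map (f x) ys)) xs) ≡ sum (map (λ y → sum (map (λ x → f x y) xs)) ys)
sum-map-swap f []       ys = sym (sum-map-0 ys)
  where
  sum-map-0 : ∀ {B : Set} (ys : List B) → sum (map (λ _ → 0) ys) ≡ 0
  sum-map-0 []       = refl
  sum-map-0 (_ ∷ ys) = sum-map-0 ys
sum-map-swap f (x ∷ xs) ys =
  trans (cong (sum (map (f x) ys) +_) (sum-map-swap f xs ys)) (sym (sum-map-+ (f x) _ ys))

sum-map-*ˡ : ∀ {A : Set} c (g : A → ℕ) xs → sum (map (λ x → c * g x) xs) ≡ c * sum (map g xs)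
sum-map-*ˡ c g []       = sym (ℕₚ.*-zeroʳ c)
sum-map-*ˡ c g (x ∷ xs) = trans (cong (c * g x +_) (sum-map-*ˡ c g xs)) (sym (ℕₚ.*-distribˡ-+ c (g x) _))

sum-map-*ʳ : ∀ {A : Set} c (g : A → ℕ) xs → sum (map (λ x → g x * c) xs) ≡ sum (map g xs) * c
sum-map-*ʳ c g []       = refl
sum-map-*ʳ c g (x ∷ xs) = trans (cong (g x * c +_) (sum-map-*ʳ c g xs)) (sym (ℕₚ.*-distribʳ-+ c (g x) _))

sum-pairs-product : ∀ {A B : Set} (f : B → A → ℕ) xs js →
  sum (map (λ u → sum (map (λ v → sum (map (λ j → f j u * f j v) js)) xs)) xs) ≡
  sum (map (λ j → sum (map (f j) xs) * sum (map (f j) xs)) js)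
sum-pairs-product {B = B} f xs js = begin
  sum (map (λ u → sum (map (λ v → sum (map (λ j → f j u * f j v) js)) xs)) xs)
    ≡⟨ cong sum (Listₚ.map-cong (λ u → sum-map-swap (λ v j → f j u * f j v) xs js) xs) ⟩
  sum (map (λ u → sum (map (λ j → sum (map (λ v → f j u * f j v) xs)) js)) xs)
    ≡⟨ cong sum (Listₚ.map-cong (λ u → cong sum (Listₚ.map-cong (λ j → sum-map-*ˡ (f j u) (f j) xs) js)) xs) ⟩
  sum (map (λ u → sum (map (λ j → f j u * R j) js)) xs)
    ≡⟨ sum-map-swap (λ u j → f j u * R j) xs js ⟩
  sum (map (λ j → sum (map (λ u → f j u * R j) xs)) js)
    ≡⟨ cong sum (Listₚ.map-cong (λ j → sum-map-*ʳ (R j) (f j) xs) js) ⟩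
  sum (map (λ j → R j * R j) js) ∎
  where
  open ≡-Reasoning
  R : B → ℕ
  R j = sum (map (f j) xs)

antitone-from-step : ∀ (f : ℕ → ℕ) {b} → (∀ {m} → m < b → f (suc m) ≤ f m) →
                     ∀ {i k} → i ≤ k → k ≤ b → f k ≤ f i
antitone-from-step f {b} step i≤k = go (ℕₚ.≤⇒≤′ i≤k)
  where
  go : ∀ {i k} → i ℕ.≤′ k → k ≤ b → f k ≤ f i
  go ℕ.≤′-refl        _     = ℕₚ.≤-refl
  go (ℕ.≤′-step i≤′k) k<b = ℕₚ.≤-trans (step k<b) (go i≤′k (ℕₚ.<⇒≤ k<b))

m≤b+n⇒[+m]-[+n]≤+b : ∀ {m n b} → m ≤ b + n → ℤ.+ m ℤ.- ℤ.+ n ℤ.≤ ℤ.+ b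
m≤b+n⇒[+m]-[+n]≤+b {m} {n} {b} m≤b+n = begin
  ℤ.+ m ℤ.- ℤ.+ n ≡⟨ ℤₚ.[+m]-[+n]≡m⊖n m n ⟩
  m ⊖ n           ≤⟨ ℤₚ.⊖-monoˡ-≤ n m≤b+n ⟩
  (b + n) ⊖ n     ≡⟨ ℤₚ.⊖-≥ (ℕₚ.m≤n+m n b) ⟩
  ℤ.+ (b + n ∸ n) ≡⟨ cong ℤ.+_ (ℕₚ.m+n∸n≡m b n) ⟩
  ℤ.+ b           ∎
  where open ℤₚ.≤-Reasoning

⟦_⟧ : ℕ → ℚ
⟦ a ⟧ = ℤ.+ a ℚ./ 1

toℚᵘ-/ : ∀ x d → ℚ.toℚᵘ (x ℚ./ suc d) ℚᵘ.≃ mkℚᵘ x d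
toℚᵘ-/ x d = ℚₚ.toℚᵘ-fromℚᵘ (mkℚᵘ x d)

/1-mono-≤ : ∀ {x y} → x ℤ.≤ y → x ℚ./ 1 ℚ.≤ y ℚ./ 1
/1-mono-≤ {x} {y} x≤y = ℚₚ.toℚᵘ-cancel-≤ (begin
  ℚ.toℚᵘ (x ℚ./ 1) ≃⟨ toℚᵘ-/ x 0 ⟩
  mkℚᵘ x 0         ≤⟨ *≤* (ℤₚ.*-monoʳ-≤-nonNeg (ℤ.+ 1) x≤y) ⟩
  mkℚᵘ y 0         ≃⟨ ℚᵘₚ.≃-sym (toℚᵘ-/ y 0) ⟩
  ℚ.toℚᵘ (y ℚ./ 1) ∎)
  where open ℚᵘₚ.≤-Reasoning

⟦⟧-+ : ∀ a b → ⟦ a + b ⟧ ≡ ⟦ a ⟧ ℚ.+ ⟦ b ⟧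
⟦⟧-+ a b = ℚₚ.toℚᵘ-injective (begin
  ℚ.toℚᵘ ⟦ a + b ⟧                        ≈⟨ toℚᵘ-/ (ℤ.+ (a + b)) 0 ⟩
  mkℚᵘ (ℤ.+ (a + b)) 0                    ≈⟨ *≡* (cong (ℤ._* ℤ.+ 1) (sym (cong₂ ℤ._+_ (ℤₚ.*-identityʳ (ℤ.+ a)) (ℤₚ.*-identityʳ (ℤ.+ b))))) ⟩
  mkℚᵘ (ℤ.+ a) 0 ℚᵘ.+ mkℚᵘ (ℤ.+ b) 0       ≈⟨ ℚᵘₚ.+-cong (toℚᵘ-/ (ℤ.+ a) 0) (toℚᵘ-/ (ℤ.+ b) 0) ⟨
  ℚ.toℚᵘ ⟦ a ⟧ ℚᵘ.+ ℚ.toℚᵘ ⟦ b ⟧          ≈⟨ ℚₚ.toℚᵘ-homo-+ ⟦ a ⟧ ⟦ b ⟧ ⟨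
  ℚ.toℚᵘ (⟦ a ⟧ ℚ.+ ⟦ b ⟧)                ∎)
  where open ℚᵘₚ.≃-Reasoning

⟦⟧*1/-≤ : ∀ r l d → r * suc d ℕ.≤ suc l → ⟦ r ⟧ ℚ.* (ℤ.+ 1 ℚ./ suc l) ℚ.≤ ℤ.+ 1 ℚ./ suc d
⟦⟧*1/-≤ r l d r[d+1]≤l+1 = ℚₚ.toℚᵘ-cancel-≤ (begin
  ℚ.toℚᵘ (⟦ r ⟧ ℚ.* (ℤ.+ 1 ℚ./ suc l))            ≃⟨ ℚₚ.toℚᵘ-homo-* ⟦ r ⟧ (ℤ.+ 1 ℚ./ suc l) ⟩
  ℚ.toℚᵘ ⟦ r ⟧ ℚᵘ.* ℚ.toℚᵘ (ℤ.+ 1 ℚ./ suc l)      ≃⟨ ℚᵘₚ.*-cong (toℚᵘ-/ (ℤ.+ r) 0) (toℚᵘ-/ (ℤ.+ 1) l) ⟩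
  mkℚᵘ (ℤ.+ r) 0 ℚᵘ.* mkℚᵘ (ℤ.+ 1) l               ≤⟨ *≤* cross ⟩
  mkℚᵘ (ℤ.+ 1) d                                  ≃⟨ ℚᵘₚ.≃-sym (toℚᵘ-/ (ℤ.+ 1) d) ⟩
  ℚ.toℚᵘ (ℤ.+ 1 ℚ./ suc d)                        ∎)
  where
  open ℚᵘₚ.≤-Reasoning
  cross : ℤ.+ r ℤ.* ℤ.+ 1 ℤ.* ℤ.+ suc d ℤ.≤ ℤ.+ 1 ℤ.* ℤ.+ (1 * suc l)
  cross = subst₂ ℤ._≤_ (trans (ℤₚ.pos-* (r * 1) (suc d)) (cong (ℤ._* ℤ.+ suc d) (ℤₚ.pos-* r 1)))
                       (ℤₚ.pos-* 1 (1 * suc l))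
                       (ℤ.+≤+ (subst₂ ℕ._≤_ (cong (_* suc d) (sym (ℕₚ.*-identityʳ r)))
                                            (sym (trans (ℕₚ.*-identityˡ _) (ℕₚ.*-identityˡ _))) r[d+1]≤l+1))

sumℚ-concatMap : ∀ {A : Set} (F : A → List ℚ) xs → sumℚ (concatMap F xs) ≡ sumℚ (map (sumℚ ∘ F) xs)
sumℚ-concatMap F []       = refl
sumℚ-concatMap F (x ∷ xs) = trans (sumℚ-++ (F x) (concatMap F xs)) (cong (sumℚ (F x) ℚ.+_) (sumℚ-concatMap F xs))
  where
  sumℚ-++ : ∀ xs ys → sumℚ (xs ++ ys) ≡ sumℚ xs ℚ.+ sumℚ ys
  sumℚ-++ []       ys = sym (ℚₚ.+-identityˡ (sumℚ ys))
  sumℚ-++ (x ∷ xs) ys = trans (cong (x ℚ.+_) (sumℚ-++ xs ys)) (sym (ℚₚ.+-assoc x (sumℚ xs) (sumℚ ys)))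

sumℚ-≤-⟦sum⟧ : ∀ {A : Set} (f : A → ℚ) (g : A → ℕ) → (∀ x → f x ℚ.≤ ⟦ g x ⟧) →
               ∀ xs → sumℚ (map f xs) ℚ.≤ ⟦ sum (map g xs) ⟧
sumℚ-≤-⟦sum⟧ f g f≤g []       = ℚₚ.≤-refl
sumℚ-≤-⟦sum⟧ f g f≤g (x ∷ xs) =
  ℚₚ.≤-trans (ℚₚ.+-mono-≤ (f≤g x) (sumℚ-≤-⟦sum⟧ f g f≤g xs)) (ℚₚ.≤-reflexive (sym (⟦⟧-+ (g x) _)))

⟦sum⟧*-≤-sumℚ : ∀ {A : Set} (g : A → ℕ) (c : ℚ) (h : A → ℚ) {xs} → All (λ x → ⟦ g x ⟧ ℚ.* c ℚ.≤ h x) xs →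
                ⟦ sum (map g xs) ⟧ ℚ.* c ℚ.≤ sumℚ (map h xs)
⟦sum⟧*-≤-sumℚ g c h []                   = ℚₚ.≤-reflexive (ℚₚ.*-zeroˡ c)
⟦sum⟧*-≤-sumℚ g c h {x ∷ xs} (gx≤hx ∷ p) = begin
  ⟦ g x + s ⟧ ℚ.* c               ≡⟨ cong (ℚ._* c) (⟦⟧-+ (g x) s) ⟩
  (⟦ g x ⟧ ℚ.+ ⟦ s ⟧) ℚ.* c       ≡⟨ ℚₚ.*-distribʳ-+ c ⟦ g x ⟧ ⟦ s ⟧ ⟩
  ⟦ g x ⟧ ℚ.* c ℚ.+ ⟦ s ⟧ ℚ.* c   ≤⟨ ℚₚ.+-mono-≤ gx≤hx (⟦sum⟧*-≤-sumℚ g c h p) ⟩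
  h x ℚ.+ sumℚ (map h xs)         ∎
  where
  open ℚₚ.≤-Reasoning
  s = sum (map g xs)

sumℚ-nonNeg : ∀ {A : Set} (f : A → ℚ) → (∀ x → 0ℚ ℚ.≤ f x) → ∀ xs → 0ℚ ℚ.≤ sumℚ (map f xs)
sumℚ-nonNeg f 0≤f []       = ℚₚ.≤-refl
sumℚ-nonNeg f 0≤f (x ∷ xs) = ℚₚ.+-mono-≤ (0≤f x) (sumℚ-nonNeg f 0≤f xs)

invSq-nonNeg : ∀ j → 0ℚ ℚ.≤ invSq j
invSq-nonNeg zero    = ℚₚ.≤-refl
invSq-nonNeg (suc j) = ℚₚ.nonNegative⁻¹ _ {{ℚₚ.normalize-nonNeg 1 (suc j * suc j)}}

average-≤ : ∀ {xs c} → 0ℚ ℚ.≤ c → (∀ l → length xs ≡ suc l → sumℚ xs ℚ.* (ℤ.+ 1 ℚ./ suc l) ℚ.≤ c) → average xs ℚ.≤ c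
average-≤ {[]}     0≤c _     = 0≤c
average-≤ {x ∷ xs} _   bound = bound (length xs) refl

-- The membership test inside distinct: distinct (x ∷ xs) unfolds to not (occurs x xs) ∧ distinct xs.
occurs : ∀ {m k} → Fin m → Vec (Fin m) k → Bool
occurs x xs = Vec.foldr _ (λ y b → (toℕ x ≡ᵇ toℕ y) ∨ b) false xs

occurs⇒lookup : ∀ {m k} {x : Fin m} (xs : Vec (Fin m) k) → T (occurs x xs) → ∃ λ q → lookup xs q ≡ x
occurs⇒lookup {x = x} (y ∷ ys) t with Equivalence.to Boolₚ.T-∨ t
... | inj₁ x≡ᵇy = Fin.zero , sym (Finₚ.toℕ-injective (ℕₚ.≡ᵇ⇒≡ (toℕ x) (toℕ y) x≡ᵇy))
... | inj₂ t′   = let q , yq≡x = occurs⇒lookup ys t′ in Fin.suc q , yq≡x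

lookup⇒occurs : ∀ {m k} (xs : Vec (Fin m) k) q → T (occurs (lookup xs q) xs)
lookup⇒occurs (y ∷ ys) Fin.zero    = Equivalence.from Boolₚ.T-∨ (inj₁ (ℕₚ.≡⇒≡ᵇ (toℕ y) (toℕ y) refl))
lookup⇒occurs (y ∷ ys) (Fin.suc q) = Equivalence.from Boolₚ.T-∨ (inj₂ (lookup⇒occurs ys q))

Injectiveᵛ : ∀ {m k} → Vec (Fin m) k → Set
Injectiveᵛ v = Injective _≡_ _≡_ (lookup v)

distinct⇒injective : ∀ {m k} (v : Vec (Fin m) k) → distinct v ≡ true → Injectiveᵛ v
distinct⇒injective (x ∷ xs) d {i} {j} e with occurs x xs in occ | distinct xs in dis
distinct⇒injective (x ∷ xs) d {Fin.zero}  {Fin.zero}  e | false | true = refl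
distinct⇒injective (x ∷ xs) d {Fin.zero}  {Fin.suc j} e | false | true =
  ⊥-elim (subst T occ (subst (λ z → T (occurs z xs)) (sym e) (lookup⇒occurs xs j)))
distinct⇒injective (x ∷ xs) d {Fin.suc i} {Fin.zero}  e | false | true =
  ⊥-elim (subst T occ (subst (λ z → T (occurs z xs)) e (lookup⇒occurs xs i)))
distinct⇒injective (x ∷ xs) d {Fin.suc i} {Fin.suc j} e | false | true = cong Fin.suc (distinct⇒injective xs dis e)

injective⇒distinct : ∀ {m k} (v : Vec (Fin m) k) → Injectiveᵛ v → distinct v ≡ true
injective⇒distinct []       _   = refl
injective⇒distinct (x ∷ xs) inj with occurs x xs in occ
... | true  = let q , xq≡x = occurs⇒lookup xs (Equivalence.from Boolₚ.T-≡ occ)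
              in contradiction (inj {Fin.zero} {Fin.suc q} (sym xq≡x)) λ ()
... | false = injective⇒distinct xs (λ e → Finₚ.suc-injective (inj e))

allVecs-complete : ∀ m k (v : Vec (Fin m) k) → v ∈ allVecs m k
allVecs-complete m zero    []       = here refl
allVecs-complete m (suc k) (x ∷ xs) = subst (_ ∈_) (sym (cartesianProductWith-concatMap _∷_ (allFin m) (allVecs m k)))
  (∈-cartesianProductWith⁺ _∷_ (∈-allFin x) (allVecs-complete m k xs))

allVecs-unique : ∀ m k → Unique (allVecs m k)
allVecs-unique m zero    = All.[] ∷ []
allVecs-unique m (suc k) = subst Unique (sym (cartesianProductWith-concatMap _∷_ (allFin m) (allVecs m k)))
  (Uniqueₚ.cartesianProductWith⁺ _∷_ Vecₚ.∷-injective (Uniqueₚ.allFin⁺ m) (allVecs-unique m k))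

∈-allPerms⁺ : ∀ {n} {w : Perm n} → Injectiveᵛ w → w ∈ allPerms n
∈-allPerms⁺ {n} {w} inj = ∈-filter⁺ (λ w → distinct w Boolₚ.≟ true) (allVecs-complete n n w) (injective⇒distinct w inj)

∈-allPerms⁻ : ∀ {n} {w : Perm n} → w ∈ allPerms n → Injectiveᵛ w
∈-allPerms⁻ {n} {w} w∈ = distinct⇒injective w (proj₂ (∈-filter⁻ (λ w → distinct w Boolₚ.≟ true) {xs = allVecs n n} w∈))

allPerms-unique : ∀ n → Unique (allPerms n)
allPerms-unique n = Uniqueₚ.filter⁺ (λ w → distinct w Boolₚ.≟ true) (allVecs-unique n n)

-- Left-to-right maxima

IsLRMax : ∀ {n} → ℕ → Perm n → Set
IsLRMax j w = χ j w ≡ 0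

isLRMax? : ∀ {n} j → Decidable (IsLRMax {n} j)
isLRMax? j w = χ j w ℕ.≟ 0

χ-binary : ∀ {n} j (w : Perm n) → χ j w ≡ 0 ⊎ χ j w ≡ 1
χ-binary j w = if-binary _
  where
  if-binary : ∀ b → (if b then 1 else 0) ≡ 0 ⊎ (if b then 1 else 0) ≡ 1
  if-binary false = inj₁ refl
  if-binary true  = inj₂ refl

lrMax : ∀ {n} → ℕ → Perm n → ℕ
lrMax j w = 1 ∸ χ j w

commonLRMaxima : ∀ {n} → ℕ → Perm n → Perm n → ℕ
commonLRMaxima {n} i u v = sum (map (λ j → lrMax j u * lrMax j v) (range i n))

1≤lrMax*lrMax+χ+χ : ∀ {n} j (u v : Perm n) → 1 ≤ lrMax j u * lrMax j v + (χ j u + χ j v)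
1≤lrMax*lrMax+χ+χ j u v with χ j u | χ j v | χ-binary j u | χ-binary j v
... | _ | _ | inj₁ refl | inj₁ refl = ℕₚ.≤-refl
... | _ | _ | inj₂ refl | _         = s≤s z≤n
... | _ | _ | inj₁ refl | inj₂ refl = ℕₚ.≤-refl

sum-lrMax≡length-filter : ∀ {n} j (ws : List (Perm n)) → sum (map (lrMax j) ws) ≡ length (filter (isLRMax? j) ws)
sum-lrMax≡length-filter j []       = refl
sum-lrMax≡length-filter j (w ∷ ws) with χ-binary j w
... | inj₁ χ≡0 rewrite Listₚ.filter-accept (isLRMax? j) {xs = ws} χ≡0 | χ≡0 = cong suc (sum-lrMax≡length-filter j ws)
... | inj₂ χ≡1 rewrite Listₚ.filter-reject (isLRMax? j) {xs = ws} (λ χ≡0 → ℕₚ.1+n≢0 (trans (sym χ≡1) χ≡0)) | χ≡1 =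
  sum-lrMax≡length-filter j ws

ext-suc-toℕ : ∀ {n} (w : Perm n) (r : Fin n) → ext w (suc (toℕ r)) ≡ suc (toℕ (lookup w r))
ext-suc-toℕ {n} w r with toℕ r ℕ.<? n
... | yes r<n = cong (λ z → suc (toℕ (lookup w z))) (Finₚ.fromℕ<-toℕ r r<n)
... | no  r≮n = contradiction (Finₚ.toℕ<n r) r≮n

lrMax-≤ : ∀ {n} {w : Perm n} {p r : Fin n} → IsLRMax (suc (toℕ p)) w → r Fin.≤ p → lookup w r Fin.≤ lookup w p
lrMax-≤ {n} {w} {p} {r} χ≡0 r≤p with ℕₚ.m≤n⇒m<n∨m≡n r≤p
... | inj₂ r≡p rewrite Finₚ.toℕ-injective r≡p = ℕₚ.≤-refl
... | inj₁ r<p = ℕₚ.≮⇒≥ λ wp<wr → ¬earlier-larger (any⁺ _ (lose (∈-range⁺ (s≤s z≤n) r<p) (wp<wr⇒T wp<wr)))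
  where
  ¬earlier-larger : ¬ T (any (λ k → ext w (suc (toℕ p)) <ᵇ ext w k) (range 1 (toℕ p)))
  ¬earlier-larger t = contradiction χ≡0 (if-true t)
    where
    if-true : ∀ {b} → T b → (if b then 1 else 0) ≢ 0
    if-true {true} _ ()
  wp<wr⇒T : toℕ (lookup w p) < toℕ (lookup w r) → T (ext w (suc (toℕ p)) <ᵇ ext w (suc (toℕ r)))
  wp<wr⇒T wp<wr rewrite ext-suc-toℕ w p | ext-suc-toℕ w r = ℕₚ.<⇒<ᵇ (s≤s wp<wr)

-- The pathwise bound

module _ {n : ℕ} (u v : Perm n) where

  Yℕ : ℕ → ℕ
  Yℕ k = Λ k u + Λ k v + (k ∸ 1)

  -- Y_{i+1} − Y_i = 1 − χ_i(u) − χ_i(v) is at most the i-th summand of commonLRMaxima,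
  -- so this potential is non-increasing.
  potential : ℕ → ℕ
  potential i = commonLRMaxima i u v + Yℕ i

  potential-step : ∀ {i} → i ≤ n → potential (suc i) ≤ potential i
  potential-step {i} i≤n = begin
    C′ + (Λ′u + Λ′v + i)                         ≤⟨ ℕₚ.+-monoʳ-≤ C′ (ℕₚ.+-monoʳ-≤ (Λ′u + Λ′v) i≤c+x+y+[i∸1]) ⟩
    C′ + (Λ′u + Λ′v + (c + (x + y) + (i ∸ 1)))   ≡⟨ regroup c C′ x y Λ′u Λ′v (i ∸ 1) ⟩
    (c + C′) + ((x + Λ′u) + (y + Λ′v) + (i ∸ 1)) ≡⟨ unfold-potential ⟨
    potential i                                  ∎
    where
    open ℕₚ.≤-Reasoning
    C′ = commonLRMaxima (suc i) u v
    Λ′u = Λ (suc i) u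
    Λ′v = Λ (suc i) v
    c = lrMax i u * lrMax i v
    x = χ i u
    y = χ i v

    i≤c+x+y+[i∸1] : i ≤ c + (x + y) + (i ∸ 1)
    i≤c+x+y+[i∸1] = ℕₚ.≤-trans (ℕₚ.m≤n+m∸n i 1) (ℕₚ.+-monoˡ-≤ (i ∸ 1) (1≤lrMax*lrMax+χ+χ i u v))

    regroup : ∀ c C x y a b e → C + (a + b + (c + (x + y) + e)) ≡ (c + C) + ((x + a) + (y + b) + e)
    regroup = solve-∀

    unfold-potential : potential i ≡ (c + C′) + ((x + Λ′u) + (y + Λ′v) + (i ∸ 1))
    unfold-potential = cong₂ (λ C L → C + (L + (i ∸ 1)))
      (sum-range-∷ (λ j → lrMax j u * lrMax j v) i≤n)
      (cong₂ _+_ (sum-range-∷ (λ j → χ j u) i≤n) (sum-range-∷ (λ j → χ j v) i≤n))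

  Yℕ-increment-≤ : ∀ {i k} → i ≤ k → k ≤ suc n → Yℕ k ≤ commonLRMaxima i u v + Yℕ i
  Yℕ-increment-≤ {k = k} i≤k k≤n+1 = ℕₚ.≤-trans (ℕₚ.m≤n+m (Yℕ k) (commonLRMaxima k u v))
    (antitone-from-step potential (λ m<n+1 → potential-step (ℕₚ.≤-pred m<n+1)) i≤k k≤n+1)

M≤commonLRMaxima : ∀ {n} i (u v : Perm n) → M i u v ℤ.≤ ℤ.+ commonLRMaxima i u v
M≤commonLRMaxima {n} i u v =
  foldr-⊔-≤ (λ k → Y k u v ℤ.- Y i u v) (range i (suc n)) (Yk-Yi≤ i (ℕₚ.m≤n+m (Yℕ u v i) (commonLRMaxima i u v)))
    (All.tabulate λ {k} k∈ → let i≤k , k≤n+1 = ∈-range⁻ k∈ in Yk-Yi≤ k (Yℕ-increment-≤ u v i≤k k≤n+1))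
  where
  Yk-Yi≤ : ∀ k → Yℕ u v k ≤ commonLRMaxima i u v + Yℕ u v i → Y k u v ℤ.- Y i u v ℤ.≤ ℤ.+ commonLRMaxima i u v
  Yk-Yi≤ _ = m≤b+n⇒[+m]-[+n]≤+b

-- How often j is a left-to-right maximum

module _ {n : ℕ} (p : Fin n) where

  swapEntries : Perm n → Fin n → Perm n
  swapEntries w q = Vec.tabulate (lookup w ∘ transpose q p)

  lookup-swapEntries : ∀ w q x → lookup (swapEntries w q) x ≡ lookup w (transpose q p x)
  lookup-swapEntries w q = Vecₚ.lookup∘tabulate (lookup w ∘ transpose q p)

  swapEntries-injective : ∀ w q → Injectiveᵛ w → Injectiveᵛ (swapEntries w q)
  swapEntries-injective w q w-inj {a} {b} e = begin
    a                               ≡⟨ transpose-inverse p q ⟨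
    transpose p q (transpose q p a) ≡⟨ cong (transpose p q) (w-inj w[σa]≡w[σb]) ⟩
    transpose p q (transpose q p b) ≡⟨ transpose-inverse p q ⟩
    b                               ∎
    where
    open ≡-Reasoning
    w[σa]≡w[σb] : lookup w (transpose q p a) ≡ lookup w (transpose q p b)
    w[σa]≡w[σb] = trans (sym (lookup-swapEntries w q a)) (trans e (lookup-swapEntries w q b))

  swapEntries-cancel : ∀ {w w′} q → swapEntries w q ≡ swapEntries w′ q → w ≡ w′
  swapEntries-cancel {w} {w′} q e = begin
    w                        ≡⟨ Vecₚ.tabulate∘lookup w ⟨
    Vec.tabulate (lookup w)  ≡⟨ Vecₚ.tabulate-cong unswap ⟩
    Vec.tabulate (lookup w′) ≡⟨ Vecₚ.tabulate∘lookup w′ ⟩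
    w′                       ∎
    where
    open ≡-Reasoning
    unswap : ∀ y → lookup w y ≡ lookup w′ y
    unswap y = begin
      lookup w y                                  ≡⟨ cong (lookup w) (transpose-inverse q p) ⟨
      lookup w (transpose q p (transpose p q y))  ≡⟨ lookup-swapEntries w q _ ⟨
      lookup (swapEntries w q) (transpose p q y)  ≡⟨ cong (λ v → lookup v (transpose p q y)) e ⟩
      lookup (swapEntries w′ q) (transpose p q y) ≡⟨ lookup-swapEntries w′ q _ ⟩
      lookup w′ (transpose q p (transpose p q y)) ≡⟨ cong (lookup w′) (transpose-inverse q p) ⟩
      lookup w′ y                                 ∎

  transpose-≤ : ∀ {q x} → q Fin.≤ p → x Fin.≤ p → transpose q p x Fin.≤ p
  transpose-≤ {q} {x} q≤p x≤p with does (x Fin.≟ q)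
  ... | true  = ℕₚ.≤-refl
  ... | false with does (x Fin.≟ p)
  ...   | true  = q≤p
  ...   | false = x≤p

  -- If w(p+1) is a left-to-right maximum, then position q of swapEntries w q carries the largest
  -- of the first p+1 values, so q can be read off from swapEntries w q.
  swapEntries-max : ∀ {w q x} → IsLRMax (suc (toℕ p)) w → q Fin.≤ p → x Fin.≤ p →
                    lookup (swapEntries w q) x Fin.≤ lookup (swapEntries w q) q
  swapEntries-max {w} {q} {x} χ≡0 q≤p x≤p =
    subst₂ Fin._≤_ (sym (lookup-swapEntries w q x)) (sym (trans (lookup-swapEntries w q q) (cong (lookup w) transpose-self)))
      (lrMax-≤ χ≡0 (transpose-≤ q≤p x≤p))
    where
    transpose-self : transpose q p q ≡ p
    transpose-self rewrite dec-true (q Fin.≟ q) refl = refl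

  swapEntries-position : ∀ {w w′ q q′} → Injectiveᵛ w → IsLRMax (suc (toℕ p)) w → IsLRMax (suc (toℕ p)) w′ →
                         q Fin.≤ p → q′ Fin.≤ p → swapEntries w q ≡ swapEntries w′ q′ → q ≡ q′
  swapEntries-position {w} {w′} {q} {q′} w-inj w-max w′-max q≤p q′≤p e =
    swapEntries-injective w q w-inj (Finₚ.≤-antisym
      (subst (λ v → lookup v q Fin.≤ lookup v q′) (sym e) (swapEntries-max w′-max q′≤p q≤p))
      (swapEntries-max w-max q≤p q′≤p))

  lrMaxima-count-≤ : suc (toℕ p) * length (filter (isLRMax? (suc (toℕ p))) (allPerms n)) ≤ length (allPerms n)
  lrMaxima-count-≤ = subst (_≤ length (allPerms n)) images-length (unique∧⊆⇒length-≤ images-unique images⊆allPerms)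
    where
    j = suc (toℕ p)
    maxima = filter (isLRMax? j) (allPerms n)

    ∈-maxima⁻ : ∀ {w} → w ∈ maxima → Injectiveᵛ w × IsLRMax j w
    ∈-maxima⁻ w∈ = let w∈P , w-max = ∈-filter⁻ (isLRMax? j) {xs = allPerms n} w∈ in ∈-allPerms⁻ w∈P , w-max

    prefix : Fin j → Fin n
    prefix m = Fin.inject≤ m (Finₚ.toℕ<n p)

    prefix-≤ : ∀ m → prefix m Fin.≤ p
    prefix-≤ m = subst (ℕ._≤ toℕ p) (sym (Finₚ.toℕ-inject≤ m (Finₚ.toℕ<n p))) (ℕₚ.≤-pred (Finₚ.toℕ<n m))

    block : Perm n → List (Perm n)
    block w = map (swapEntries w ∘ prefix) (allFin j)

    images = concatMap block maxima

    images-length : length images ≡ j * length maxima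
    images-length = trans (length-concatMap block block-length maxima) (ℕₚ.*-comm (length maxima) j)
      where
      block-length : ∀ w → length (block w) ≡ j
      block-length w = trans (Listₚ.length-map _ (allFin j)) (Listₚ.length-tabulate (λ m → m))

    images-unique : Unique images
    images-unique = concatMap-unique block (Uniqueₚ.filter⁺ (isLRMax? j) (allPerms-unique n))
      (λ {w} w∈ → let w-inj , w-max = ∈-maxima⁻ w∈ in
        Uniqueₚ.map⁺ (λ {m} {m′} e → Finₚ.inject≤-injective _ _ m m′
                                       (swapEntries-position {w} w-inj w-max w-max (prefix-≤ m) (prefix-≤ m′) e))
                     (Uniqueₚ.allFin⁺ j))
      λ {w} {w′} w∈ w′∈ w≢w′ (b∈ , b∈′) →
        let w-inj , w-max = ∈-maxima⁻ w∈
            _ , w′-max = ∈-maxima⁻ w′∈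
            m , _ , b≡ = ∈-map⁻ (swapEntries w ∘ prefix) b∈
            m′ , _ , b≡′ = ∈-map⁻ (swapEntries w′ ∘ prefix) b∈′
            same-image = trans (sym b≡) b≡′
            m≡m′ = swapEntries-position w-inj w-max w′-max (prefix-≤ m) (prefix-≤ m′) same-image
        in w≢w′ (swapEntries-cancel (prefix m) (trans same-image (cong (swapEntries w′) (sym m≡m′))))

    images⊆allPerms : images ⊆ allPerms n
    images⊆allPerms b∈ =
      let w , w∈ , b∈block = find (∈-concatMap⁻ block b∈)
          m , _ , b≡ = ∈-map⁻ (swapEntries w ∘ prefix) b∈block
      in subst (_∈ allPerms n) (sym b≡) (∈-allPerms⁺ (swapEntries-injective w (prefix m) (proj₁ (∈-maxima⁻ w∈))))

lrMax-frequency-≤ : ∀ {n j} → 1 ≤ j → j ≤ n → j * sum (map (lrMax j) (allPerms n)) ≤ length (allPerms n)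
lrMax-frequency-≤ {n} {suc j} _ j<n rewrite sum-lrMax≡length-filter (suc j) (allPerms n) =
  subst (λ t → suc t * length (filter (isLRMax? (suc t)) (allPerms n)) ≤ length (allPerms n))
        (Finₚ.toℕ-fromℕ< j<n) (lrMaxima-count-≤ (Fin.fromℕ< j<n))

lrMax-frequency²-≤ : ∀ {n j l} → 1 ≤ j → j ≤ n → suc l ≡ length (allPerms n) * length (allPerms n) →
  let R = sum (map (lrMax j) (allPerms n)) in ⟦ R * R ⟧ ℚ.* (ℤ.+ 1 ℚ./ suc l) ℚ.≤ invSq j
lrMax-frequency²-≤ {n} {suc j} {l} 1≤j j≤n l+1≡N² = ⟦⟧*1/-≤ (R * R) l (j + j * suc j) (begin
  R * R * (suc j * suc j)       ≡⟨ regroup R (suc j) ⟩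
  (suc j * R) * (suc j * R)     ≤⟨ ℕₚ.*-mono-≤ jR≤N jR≤N ⟩
  N * N                         ≡⟨ l+1≡N² ⟨
  suc l                         ∎)
  where
  open ℕₚ.≤-Reasoning
  N = length (allPerms n)
  R = sum (map (lrMax (suc j)) (allPerms n))
  jR≤N : suc j * R ≤ N
  jR≤N = lrMax-frequency-≤ 1≤j j≤n
  regroup : ∀ r k → r * r * (k * k) ≡ (k * r) * (k * r)
  regroup = solve-∀

sumℚ-M≤⟦sum-commonLRMaxima⟧ : ∀ {n} i (ws : List (Perm n)) →
  sumℚ (concatMap (λ u → map (λ v → M i u v ℚ./ 1) ws) ws) ℚ.≤ ⟦ sum (map (λ u → sum (map (commonLRMaxima i u) ws)) ws) ⟧
sumℚ-M≤⟦sum-commonLRMaxima⟧ i ws = ℚₚ.≤-trans (ℚₚ.≤-reflexive (sumℚ-concatMap _ ws))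
  (sumℚ-≤-⟦sum⟧ _ _ (λ u → sumℚ-≤-⟦sum⟧ _ _ (λ v → /1-mono-≤ (M≤commonLRMaxima i u v)) ws) ws)

lemma3p4 : (n : ℕ) → 1 ≤ n → (i : ℕ) → 1 ≤ i → i ≤ n →
    expectedMax n i ≤ℚ sumInvSq i n
lemma3p4 n _ i 1≤i _ = average-≤ {samples} (sumℚ-nonNeg invSq invSq-nonNeg (range i n)) bound
  where
  P = allPerms n
  samples = concatMap (λ u → map (λ v → M i u v ℚ./ 1) P) P
  R = λ j → sum (map (lrMax j) P)

  bound : ∀ l → length samples ≡ suc l → sumℚ samples ℚ.* (ℤ.+ 1 ℚ./ suc l) ℚ.≤ sumInvSq i n
  bound l |samples|≡l+1 = begin
    sumℚ samples ℚ.* c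
      ≤⟨ ℚₚ.*-monoʳ-≤-nonNeg c {{ℚₚ.normalize-nonNeg 1 (suc l)}} (sumℚ-M≤⟦sum-commonLRMaxima⟧ i P) ⟩
    ⟦ sum (map (λ u → sum (map (commonLRMaxima i u) P)) P) ⟧ ℚ.* c
      ≡⟨ cong (λ t → ⟦ t ⟧ ℚ.* c) (sum-pairs-product lrMax P (range i n)) ⟩
    ⟦ sum (map (λ j → R j * R j) (range i n)) ⟧ ℚ.* c
      ≤⟨ ⟦sum⟧*-≤-sumℚ _ c invSq (All.tabulate λ j∈ → let i≤j , j≤n = ∈-range⁻ j∈ in
           lrMax-frequency²-≤ (ℕₚ.≤-trans 1≤i i≤j) j≤n l+1≡|P|²) ⟩
    sumInvSq i n ∎
    where
    open ℚₚ.≤-Reasoning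
    c = ℤ.+ 1 ℚ./ suc l
    l+1≡|P|² : suc l ≡ length P * length P
    l+1≡|P|² = trans (sym |samples|≡l+1) (length-concatMap _ (λ u → Listₚ.length-map _ P) P)
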